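{- Let $r\in\mathbb Q$ with continued fraction expansion $r=[a_0,\dots,a_n]=a_0+1/(a_1+\dots+1/a_n)$ and convergents $p_j/q_j$, with $p_{ -2}=0$, $q_{ -2}=1$, $p_{ -1}=1$, $q_{ -1}=0$. Put $a_{n+1}=-q_{n-1}/q_n$ and, for $-1\le j\le n$, $\tau_j=\begin{pmatrix}(-1)^{j-1}p_j&p_{j-1}\\(-1)^{j-1}q_j&q_{j-1}\end{pmatrix}$. Then in $\Xi_0$, $$[\pi_0(\infty),\pi_r(\infty)]+\sum_{j=-1}^{n}\tau_j[\pi_\infty((-1)^{j+1}a_{j+1}),\pi_0(\infty)]=0.$$
   Context: $\mathcal P(\mathbb Q)$ is the set of formal symbols $\pi_r(s)$ for $r\ne s\in\mathbb P^1(\mathbb Q)$, with $\gamma\pi_r(s)=\pi_{\gamma r}(\gamma s)$ for $\gamma\in\mathrm{GL}_2(\mathbb Q)$ acting by Möbius transformations. $\Xi_0$ is the group of degree-zero divisors on $\mathcal P(\mathbb Q)$ and $[c_1,c_2]=\{c_2\}-\{c_1\}$. -}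

module Defs where

open import Data.Nat using (ℕ; zero; suc)
import Data.Nat as ℕ
open import Data.Integer as ℤ using (ℤ; +_; _*_; _+_; _-_; -_; 0ℤ)
import Data.Integer.Properties as ℤP
open import Data.Integer.Solver renaming (module +-*-Solver to ℤ-solver)
open import Data.Rational as ℚ using (ℚ; ↥_; ↧_; 0ℚ; 1ℚ)
import Data.Rational.Properties as ℚP
open import Data.Product using (_×_; _,_; proj₁; proj₂)
open import Data.Sum using (inj₁; inj₂)
open import Data.List using (List; []; _∷_; _++_; map; foldr)
open import Data.Bool using (if_then_else_)
open import Relation.Nullary using (¬_; Dec; yes; no; does; _×-dec_)
open import Relation.Binary.PropositionalEquality
open import Data.Empty using (⊥-elim)
open import Data.Empty.Irrelevant renaming (⊥-elim to ⊥-elim-irr)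

-- P¹(ℚ) in homogeneous integer coordinates (x : y), (x,y) ≠ (0,0).
-- The point x/y ∈ ℚ is (x : y); ∞ is (1 : 0).

record P1 : Set where
  constructor ⟨_∶_∣_⟩
  field
    x : ℤ
    y : ℤ
    .nz : ¬ (x ≡ 0ℤ × y ≡ 0ℤ)
open P1

_~_ : P1 → P1 → Set
P ~ Q = x P * y Q ≡ x Q * y P

_~?_ : (P Q : P1) → Dec (P ~ Q)
P ~? Q = x P * y Q ℤP.≟ x Q * y P

∞ : P1
∞ = ⟨ + 1 ∶ + 0 ∣ (λ { (() , _) }) ⟩

denom≢0 : ∀ q → ¬ (↧ q ≡ 0ℤ)
denom≢0 (ℚ.mkℚ _ _ _) ()

fin : ℚ → P1
fin q = ⟨ ↥ q ∶ ↧ q ∣ (λ { (_ , e) → denom≢0 q e }) ⟩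

-- Elements of GL₂(ℚ) with integer entries (enough for the τ_j), acting
-- on P¹(ℚ) by Möbius transformations  z ↦ (a z + b)/(c z + d).

record GL2 : Set where
  constructor mat
  field
    a b c d : ℤ
    .det≢0 : ¬ (a * d - b * c ≡ 0ℤ)
open GL2

private
  id₁ : ∀ a b c d x y →
        d * (a * x + b * y) - b * (c * x + d * y) ≡ (a * d - b * c) * x
  id₁ = ℤ-solver.solve 6 (λ a b c d x y →
          d :* (a :* x :+ b :* y) :- b :* (c :* x :+ d :* y) :=
          (a :* d :- b :* c) :* x) refl
    where open ℤ-solver
  id₂ : ∀ a b c d x y →
        a * (c * x + d * y) - c * (a * x + b * y) ≡ (a * d - b * c) * y
  id₂ = ℤ-solver.solve 6 (λ a b c d x y →
          a :* (c :* x :+ d :* y) :- c :* (a :* x :+ b :* y) :=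
          (a :* d :- b :* c) :* y) refl
    where open ℤ-solver
  id₃ : ∀ a b c d x y x' y' →
        (a * x + b * y) * (c * x' + d * y') - (a * x' + b * y') * (c * x + d * y)
        ≡ (a * d - b * c) * (x * y' - x' * y)
  id₃ = ℤ-solver.solve 8 (λ a b c d x y x' y' →
          (a :* x :+ b :* y) :* (c :* x' :+ d :* y') :- (a :* x' :+ b :* y') :* (c :* x :+ d :* y) :=
          (a :* d :- b :* c) :* (x :* y' :- x' :* y)) refl
    where open ℤ-solver

  zero-lemma : ∀ (δ t : ℤ) → .(¬ δ ≡ 0ℤ) → δ * t ≡ 0ℤ → t ≡ 0ℤ
  zero-lemma δ t δ≢0 e with ℤP.i*j≡0⇒i≡0∨j≡0 δ e
  ... | inj₁ p = ⊥-elim-irr (δ≢0 p)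
  ... | inj₂ p = p

  sub0 : ∀ (u v : ℤ) → u ≡ 0ℤ → v ≡ 0ℤ → u - v ≡ 0ℤ
  sub0 u v refl refl = refl

  scale0 : ∀ (k u : ℤ) → u ≡ 0ℤ → k * u ≡ 0ℤ
  scale0 k u refl = ℤP.*-zeroʳ k

actP : GL2 → P1 → P1
actP (mat a b c d δ≢0) ⟨ x ∶ y ∣ nz ⟩ =
  ⟨ a * x + b * y ∶ c * x + d * y ∣ (λ (e₁ , e₂) → nz
      ( zero-lemma _ x δ≢0 (trans (sym (id₁ a b c d x y))
          (sub0 _ _ (scale0 d _ e₁) (scale0 b _ e₂)))
      , zero-lemma _ y δ≢0 (trans (sym (id₂ a b c d x y))
          (sub0 _ _ (scale0 a _ e₂) (scale0 c _ e₁))) )) ⟩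

actP-inj : ∀ (M : GL2) (P Q : P1) → actP M P ~ actP M Q → P ~ Q
actP-inj (mat a b c d δ≢0) ⟨ x ∶ y ∣ _ ⟩ ⟨ x' ∶ y' ∣ _ ⟩ e =
  ℤP.i-j≡0⇒i≡j _ _ (zero-lemma _ _ δ≢0
    (trans (sym (id₃ a b c d x y x' y')) (ℤP.i≡j⇒i-j≡0 e)))

record Sym : Set where
  constructor π
  field
    r s : P1
    .r≁s : ¬ (r ~ s)
open Sym

actS : GL2 → Sym → Sym
actS M (π r s r≁s) = π (actP M r) (actP M s) (λ e → r≁s (actP-inj M r s e))

_≈S?_ : (σ τ : Sym) → Dec ((r σ ~ r τ) × (s σ ~ s τ))
σ ≈S? τ = (r σ ~? r τ) ×-dec (s σ ~? s τ)

-- Divisors on 𝒫(ℚ): finite formal ℤ-linear combinations, given as lists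
-- of (coefficient, symbol); equality is equality of all coefficients.

Div : Set
Div = List (ℤ × Sym)

coeff : Div → Sym → ℤ
coeff D σ = foldr (λ (n , τ) acc → (if does (τ ≈S? σ) then n else 0ℤ) + acc) 0ℤ D

-- D = 0 in the free abelian group on 𝒫(ℚ) (hence in Ξ₀)
IsZeroDiv : Div → Set
IsZeroDiv D = ∀ σ → coeff D σ ≡ 0ℤ

[_,_] : Sym → Sym → Div
[ c₁ , c₂ ] = (+ 1 , c₂) ∷ (ℤ.-[1+ 0 ] , c₁) ∷ []

_·D_ : GL2 → Div → Div
M ·D D = map (λ (n , σ) → (n , actS M σ)) D

ΣD : ℕ → (ℕ → Div) → Div
ΣD zero f = f 0
ΣD (suc m) f = ΣD m f ++ f (suc m)

-- total inverse on ℚ (1/0 := 0; never used at 0 under the hypotheses)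
inv : ℚ → ℚ
inv q with q ℚP.≟ 0ℚ
... | yes _ = 0ℚ
... | no q≢0 = ℚ.1/_ q {{ℚ.≢-nonZero q≢0}}

-- [a_i, a_{i+1}, …, a_{i+k}] = a_i + 1/(a_{i+1} + … + 1/a_{i+k})
cfFrom : (ℕ → ℤ) → ℕ → ℕ → ℚ
cfFrom a zero i = a i ℚ./ 1
cfFrom a (suc k) i = (a i ℚ./ 1) ℚ.+ inv (cfFrom a k (suc i))

cf : (ℕ → ℤ) → ℕ → ℚ
cf a n = cfFrom a n 0

-- shifted convergents: pp a k = p_{k-2}, qq a k = q_{k-2}
pp : (ℕ → ℤ) → ℕ → ℤ
pp a 0 = 0ℤ
pp a 1 = + 1
pp a (suc (suc k)) = a k * pp a (suc k) + pp a k

qq : (ℕ → ℤ) → ℕ → ℤ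
qq a 0 = + 1
qq a 1 = 0ℤ
qq a (suc (suc k)) = a k * qq a (suc k) + qq a k

sg : ℕ → ℤ
sg zero = + 1
sg (suc k) = - sg k

private
  detStep : ∀ u P₀ P₁ Q₀ Q₁ →
    (u * P₁ + P₀) * Q₁ - P₁ * (u * Q₁ + Q₀) ≡ - (P₁ * Q₀ - P₀ * Q₁)
  detStep = ℤ-solver.solve 5 (λ u P₀ P₁ Q₀ Q₁ →
     (u :* P₁ :+ P₀) :* Q₁ :- P₁ :* (u :* Q₁ :+ Q₀) := :- (P₁ :* Q₀ :- P₀ :* Q₁)) refl
    where open ℤ-solver

  detPQ : ∀ a k → pp a (suc k) * qq a k - pp a k * qq a (suc k) ≡ sg k
  detPQ a zero = refl
  detPQ a (suc k) = trans (detStep (a k) (pp a k) (pp a (suc k)) (qq a k) (qq a (suc k)))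
                          (cong -_ (detPQ a k))

  sgsg : ∀ k → sg k * sg k ≡ + 1
  sgsg zero = refl
  sgsg (suc k) = trans (negsq (sg k)) (sgsg k)
    where
    negsq : ∀ t → (- t) * (- t) ≡ t * t
    negsq = ℤ-solver.solve 1 (λ t → (:- t) :* (:- t) := t :* t) refl
      where open ℤ-solver

  detτ : ∀ a k → sg k * pp a (suc k) * qq a k - pp a k * (sg k * qq a (suc k)) ≡ + 1
  detτ a k = trans (re (sg k) (pp a (suc k)) (qq a k) (pp a k) (qq a (suc k)))
                   (trans (cong (sg k *_) (detPQ a k)) (sgsg k))
    where
    re : ∀ s P₁ Q₀ P₀ Q₁ → s * P₁ * Q₀ - P₀ * (s * Q₁) ≡ s * (P₁ * Q₀ - P₀ * Q₁)
    re = ℤ-solver.solve 5 (λ s P₁ Q₀ P₀ Q₁ →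
           s :* P₁ :* Q₀ :- P₀ :* (s :* Q₁) := s :* (P₁ :* Q₀ :- P₀ :* Q₁)) refl
      where open ℤ-solver

one≢0 : ¬ (+ 1 ≡ 0ℤ)
one≢0 ()

-- τ_j for j = k − 1 (so k = 0, …, n+1 ↔ j = −1, …, n):
--   τ_j = ( (-1)^{j-1} p_j   p_{j-1} ; (-1)^{j-1} q_j   q_{j-1} ),  (-1)^{j-1} = (-1)^k
τ : (ℕ → ℤ) → ℕ → GL2
τ a k = mat (sg k * pp a (suc k)) (pp a k) (sg k * qq a (suc k)) (qq a k)
            (λ e → one≢0 (trans (sym (detτ a k)) e))

aNext : (ℕ → ℤ) → ℕ → ℚ
aNext a n = ℚ.- ((qq a (suc n) ℚ./ 1) ℚ.* inv (qq a (suc (suc n)) ℚ./ 1))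

aExt : (ℕ → ℤ) → ℕ → ℕ → ℚ
aExt a n k = if k ℕ.≤ᵇ n then a k ℚ./ 1 else aNext a n

0ₚ : P1
0ₚ = fin 0ℚ

π₀∞ : Sym
π₀∞ = π 0ₚ ∞ (λ ())

πfin∞ : ℚ → Sym
πfin∞ q = π (fin q) ∞ (λ e → denom≢0 q (trans (sym (ℤP.*-identityˡ (↧ q)))
                                  (trans (sym e) (ℤP.*-zeroʳ (↥ q)))))

π∞fin : ℚ → Sym
π∞fin q = π ∞ (fin q) (λ e → denom≢0 q (trans (sym (ℤP.*-identityˡ (↧ q)))
                                  (trans e (ℤP.*-zeroʳ (↥ q)))))

module Submission where

-- Index the terms by k = j + 1 (so `τ a k`
-- is τ_{k−1}) and write α_k = τ_{k−1} π_∞((−1)^k a_k), β_k = τ_{k−1} π₀(∞).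
-- The sum is Σ_k ({β_k} − {α_k}), and it telescopes because consecutive
-- terms share an endpoint:
--   β_0 = π₀(∞),   α_k = β_{k+1} (k ≤ n),   α_{n+1} = π_r(∞).
-- The sum therefore equals {π₀(∞)} − {π_r(∞)}, cancelling [π₀(∞), π_r(∞)].

open import Defs
open import Data.Nat using (ℕ; zero; suc; _≤_; _<_; z≤n; s≤s)
import Data.Nat as ℕ
import Data.Nat.Properties as ℕP
open import Data.Integer using (ℤ; +_; _*_; _+_; _-_; -_; 0ℤ; +[1+_]; -[1+_])
import Data.Integer as ℤ
import Data.Integer.Properties as ℤP
open import Data.Integer.Tactic.RingSolver using (solve-∀; solve)
open import Data.Rational as ℚ using (ℚ; ↥_; ↧_; 0ℚ; mkℚ)
import Data.Rational.Properties as ℚP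
open import Data.List using ([]; _∷_; _++_)
open import Data.Product using (Σ; _×_; _,_; proj₁; proj₂)
open import Data.Sum using (inj₁; inj₂)
open import Data.Bool using (true; false; if_then_else_)
open import Data.Bool.Properties using (T-≡)
open import Data.Empty using (⊥-elim)
import Data.Empty.Irrelevant as Irrelevant
open import Function using (_∘_)
open import Function.Bundles using (Equivalence; mk⇔)
open import Relation.Nullary using (¬_; yes; no; does)
open import Relation.Nullary.Decidable using (does-⇔)
open import Relation.Binary.PropositionalEquality
  using (_≡_; _≢_; refl; sym; trans; cong; cong₂; subst; module ≡-Reasoning)

record _≍_ (P Q : ℤ × ℤ) : Set where
  constructor cross
  field cross-eq : proj₁ P * proj₂ Q ≡ proj₁ Q * proj₂ P

≍-trans : ∀ {x y x' y' x'' y''} → .(¬ (x' ≡ 0ℤ × y' ≡ 0ℤ)) →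
          (x , y) ≍ (x' , y') → (x' , y') ≍ (x'' , y'') → (x , y) ≍ (x'' , y'')
≍-trans {x} {y} {x'} {y'} {x''} {y''} nz (cross e₁) (cross e₂) with y' ℤP.≟ 0ℤ | x' ℤP.≟ 0ℤ
... | no y'≢0 | _ = cross (ℤP.*-cancelʳ-≡ _ _ y' {{ℤ.≢-nonZero y'≢0}} via-y')
  where
  open ≡-Reasoning
  via-y' : x * y'' * y' ≡ x'' * y * y'
  via-y' = begin
    x * y'' * y'    ≡⟨ solve (x ∷ y' ∷ y'' ∷ []) ⟩
    y'' * (x * y')  ≡⟨ cong (y'' *_) e₁ ⟩
    y'' * (x' * y)  ≡⟨ solve (x' ∷ y ∷ y'' ∷ []) ⟩
    y * (x' * y'')  ≡⟨ cong (y *_) e₂ ⟩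
    y * (x'' * y')  ≡⟨ solve (x'' ∷ y ∷ y' ∷ []) ⟩
    x'' * y * y'    ∎
... | yes _ | no x'≢0 = cross (ℤP.*-cancelʳ-≡ _ _ x' {{ℤ.≢-nonZero x'≢0}} via-x')
  where
  open ≡-Reasoning
  via-x' : x * y'' * x' ≡ x'' * y * x'
  via-x' = begin
    x * y'' * x'    ≡⟨ solve (x ∷ x' ∷ y'' ∷ []) ⟩
    x * (x' * y'')  ≡⟨ cong (x *_) e₂ ⟩
    x * (x'' * y')  ≡⟨ solve (x ∷ x'' ∷ y' ∷ []) ⟩
    x'' * (x * y')  ≡⟨ cong (x'' *_) e₁ ⟩
    x'' * (x' * y)  ≡⟨ solve (x' ∷ x'' ∷ y ∷ []) ⟩
    x'' * y * x'    ∎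
... | yes y'≡0 | yes x'≡0 = Irrelevant.⊥-elim (nz (x'≡0 , y'≡0))

≍-scaleʳ : ∀ l {x y u v} → (x , y) ≍ (u , v) → (x , y) ≍ (l * u , l * v)
≍-scaleʳ l {x} {y} {u} {v} (cross e) = cross (begin
  x * (l * v)  ≡⟨ solve (l ∷ x ∷ v ∷ []) ⟩
  l * (x * v)  ≡⟨ cong (l *_) e ⟩
  l * (u * y)  ≡⟨ solve (l ∷ u ∷ y ∷ []) ⟩
  l * u * y    ∎)
  where open ≡-Reasoning

≍-sym : ∀ {P Q} → P ≍ Q → Q ≍ P
≍-sym (cross e) = cross (sym e)

≍-scaled : ∀ l u v → (l * u , l * v) ≍ (u , v)
≍-scaled l u v = cross (solve (l ∷ u ∷ v ∷ []))

≍-≡ : ∀ {u v u' v' x y x' y'} → (u , v) ≍ (u' , v') →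
      u ≡ x → v ≡ y → u' ≡ x' → v' ≡ y' → (x , y) ≍ (x' , y')
≍-≡ e refl refl refl refl = e

≍-≡ʳ : ∀ {x y u v u' v'} → (x , y) ≍ (u , v) → u ≡ u' → v ≡ v' → (x , y) ≍ (u' , v')
≍-≡ʳ e = ≍-≡ e refl refl

≍-möbius : ∀ A B C D {x y x' y'} → (x , y) ≍ (x' , y') →
           (A * x + B * y , C * x + D * y) ≍ (A * x' + B * y' , C * x' + D * y')
≍-möbius A B C D {x} {y} {x'} {y'} (cross e) = cross (ℤP.i-j≡0⇒i≡j _ _ (begin
  (A * x + B * y) * (C * x' + D * y') - (A * x' + B * y') * (C * x + D * y)
    ≡⟨ solve (A ∷ B ∷ C ∷ D ∷ x ∷ y ∷ x' ∷ y' ∷ []) ⟩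
  (A * D - B * C) * (x * y' - x' * y)  ≡⟨ cong ((A * D - B * C) *_) (ℤP.i≡j⇒i-j≡0 e) ⟩
  (A * D - B * C) * 0ℤ                 ≡⟨ ℤP.*-zeroʳ (A * D - B * C) ⟩
  0ℤ                                   ∎))
  where open ≡-Reasoning

≍-mul : ∀ {x y u v x' y' u' v'} → (x , y) ≍ (u , v) → (x' , y') ≍ (u' , v') →
        (x * x' , y * y') ≍ (u * u' , v * v')
≍-mul {x} {y} {u} {v} {x'} {y'} {u'} {v'} (cross e) (cross e') = cross (begin
  x * x' * (v * v')    ≡⟨ solve (x ∷ x' ∷ v ∷ v' ∷ []) ⟩
  (x * v) * (x' * v')  ≡⟨ cong₂ _*_ e e' ⟩
  (u * y) * (u' * y')  ≡⟨ solve (u ∷ y ∷ u' ∷ y' ∷ []) ⟩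
  u * u' * (y * y')    ∎)
  where open ≡-Reasoning

≍-add : ∀ {x y u v x' y' u' v'} → (x , y) ≍ (u , v) → (x' , y') ≍ (u' , v') →
        (x * y' + x' * y , y * y') ≍ (u * v' + u' * v , v * v')
≍-add {x} {y} {u} {v} {x'} {y'} {u'} {v'} (cross e) (cross e') = cross (begin
  (x * y' + x' * y) * (v * v')                ≡⟨ solve (x ∷ y ∷ x' ∷ y' ∷ v ∷ v' ∷ []) ⟩
  (x * v) * (y' * v') + (x' * v') * (y * v)   ≡⟨ cong₂ (λ s t → s * (y' * v') + t * (y * v)) e e' ⟩
  (u * y) * (y' * v') + (u' * y') * (y * v)   ≡⟨ solve (u ∷ y ∷ u' ∷ y' ∷ v ∷ v' ∷ []) ⟩
  (u * v' + u' * v) * (y * y')                ∎)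
  where open ≡-Reasoning

point : P1 → ℤ × ℤ
point P = (P1.x P , P1.y P)

≍⇒~ : ∀ P Q → point P ≍ point Q → P ~ Q
≍⇒~ P Q = _≍_.cross-eq

~⇒≍ : ∀ P Q → P ~ Q → point P ≍ point Q
~⇒≍ P Q = cross

~-trans : ∀ P Q R → P ~ Q → Q ~ R → P ~ R
~-trans P Q@(⟨ _ ∶ _ ∣ nz ⟩) R e₁ e₂ =
  ≍⇒~ P R (≍-trans nz (~⇒≍ P Q e₁) (~⇒≍ Q R e₂))

~∞ : ∀ P → P1.y P ≡ 0ℤ → P ~ ∞
~∞ P y≡0 = trans (ℤP.*-zeroʳ (P1.x P)) (sym (trans (ℤP.*-identityˡ (P1.y P)) y≡0))

actP-cong : ∀ M P Q → P ~ Q → actP M P ~ actP M Q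
actP-cong M@(mat A B C D _) P@(⟨ _ ∶ _ ∣ _ ⟩) Q@(⟨ _ ∶ _ ∣ _ ⟩) e =
  ≍⇒~ (actP M P) (actP M Q) (≍-möbius A B C D (~⇒≍ P Q e))

coords : ℚ → ℤ × ℤ
coords q = (↥ q , ↧ q)

-- The library describes ℚ-operations up to a common (gcd) factor g.
≍-common-factor : ∀ {X Y u v} g → X * g ≡ u → Y * g ≡ v → (X , Y) ≍ (u , v)
≍-common-factor {X} {Y} {u} {v} g refl refl = cross (begin
  X * (Y * g)  ≡⟨ solve (X ∷ Y ∷ g ∷ []) ⟩
  X * g * Y    ∎)
  where open ≡-Reasoning

denominator-nz : ∀ {x d} → d ≢ 0ℤ → ¬ (x ≡ 0ℤ × d ≡ 0ℤ)
denominator-nz d≢0 (_ , d≡0) = d≢0 d≡0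

denominators-nz : ∀ p q → ↧ p * ↧ q ≢ 0ℤ
denominators-nz p q e with ℤP.i*j≡0⇒i≡0∨j≡0 (↧ p) e
... | inj₁ e₁ = denom≢0 p e₁
... | inj₂ e₂ = denom≢0 q e₂

coords-/1 : ∀ i → coords (i ℚ./ 1) ≍ (i , + 1)
coords-/1 i = ≍-common-factor _ (ℚP.↥-/ i 1) (ℚP.↧-/ i 1)

coords-* : ∀ p q {u v u' v'} → coords p ≍ (u , v) → coords q ≍ (u' , v') →
           coords (p ℚ.* q) ≍ (u * u' , v * v')
coords-* p q e e' = ≍-trans (denominator-nz (denominators-nz p q))
  (≍-common-factor _ (ℚP.↥-* p q) (ℚP.↧-* p q)) (≍-mul e e')

coords-+ : ∀ p q {u v u' v'} → coords p ≍ (u , v) → coords q ≍ (u' , v') →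
           coords (p ℚ.+ q) ≍ (u * v' + u' * v , v * v')
coords-+ p q e e' = ≍-trans (denominator-nz (denominators-nz p q))
  (≍-common-factor _ (ℚP.↥-+ p q) (ℚP.↧-+ p q)) (≍-add e e')

coords-neg : ∀ p {u v} → coords p ≍ (u , v) → coords (ℚ.- p) ≍ (- u , v)
coords-neg p {u} {v} (cross e) = cross (begin
  ↥ (ℚ.- p) * v  ≡⟨ cong (_* v) (ℚP.↥-neg p) ⟩
  - ↥ p * v      ≡⟨ ℤP.neg-distribˡ-* (↥ p) v ⟨
  - (↥ p * v)    ≡⟨ cong -_ e ⟩
  - (u * ↧ p)    ≡⟨ ℤP.neg-distribˡ-* u (↧ p) ⟩
  - u * ↧ p      ≡⟨ cong (- u *_) (ℚP.↧-neg p) ⟨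
  - u * ↧ (ℚ.- p) ∎)
  where open ≡-Reasoning

coords≢0 : ∀ {q u v} → coords q ≍ (u , v) → u ≢ 0ℤ → q ≢ 0ℚ
coords≢0 {u = u} {v} (cross e) u≢0 refl =
  u≢0 (trans (sym (ℤP.*-identityʳ u)) (trans (sym e) (ℤP.*-zeroˡ v)))

coords-1/ : ∀ q .{{_ : ℚ.NonZero q}} → coords (ℚ.1/ q) ≍ (↧ q , ↥ q)
coords-1/ (mkℚ +[1+ _ ] _ _) = cross refl
coords-1/ (mkℚ -[1+ _ ] _ _) = cross refl

coords-inv : ∀ q {u v} → coords q ≍ (u , v) → u ≢ 0ℤ → coords (inv q) ≍ (v , u)
coords-inv q {u} {v} (cross e) u≢0 with q ℚP.≟ 0ℚ
... | yes q≡0 = ⊥-elim (coords≢0 (cross e) u≢0 q≡0)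
... | no q≢0 = ≍-trans (λ (d≡0 , _) → denom≢0 q d≡0)
  (coords-1/ q {{ℚ.≢-nonZero q≢0}}) flipped
  where
  flipped : (↧ q , ↥ q) ≍ (v , u)
  flipped = cross (trans (ℤP.*-comm (↧ q) u) (trans (sym e) (ℤP.*-comm (↥ q) v)))

coords-int-* : ∀ i q {u v} → coords q ≍ (u , v) → coords ((i ℚ./ 1) ℚ.* q) ≍ (i * u , v)
coords-int-* i q e = ≍-≡ʳ (coords-* (i ℚ./ 1) q (coords-/1 i) e) refl (ℤP.*-identityˡ _)

cfFrom-shift : ∀ a k i → cfFrom a k (suc i) ≡ cfFrom (a ∘ suc) k i
cfFrom-shift a zero i = refl
cfFrom-shift a (suc k) i =
  cong (λ t → (a (suc i) ℚ./ 1) ℚ.+ inv t) (cfFrom-shift a k (suc i))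

-- Convergents of [a₀; a₁, …] from those p', q' of [a₁; a₂, …]:
-- p = a₀ p' + q' and q = p'.  This turns the forward recursion defining
-- pp, qq into the backward recursion defining cfFrom.
pp-tail : ∀ a m → pp a (suc m) ≡ a 0 * pp (a ∘ suc) m + qq (a ∘ suc) m
pp-tail a zero = sym (cong (_+ + 1) (ℤP.*-zeroʳ (a 0)))
pp-tail a (suc zero) = refl
pp-tail a (suc (suc m)) = begin
  a (suc m) * pp a (suc (suc m)) + pp a (suc m)
    ≡⟨ cong₂ (λ u v → a (suc m) * u + v) (pp-tail a (suc m)) (pp-tail a m) ⟩
  a (suc m) * (a 0 * P₁ + Q₁) + (a 0 * P₀ + Q₀)
    ≡⟨ regroup (a (suc m)) (a 0) P₁ Q₁ P₀ Q₀ ⟩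
  a 0 * (a (suc m) * P₁ + P₀) + (a (suc m) * Q₁ + Q₀)  ∎
  where
  open ≡-Reasoning
  P₁ Q₁ P₀ Q₀ : ℤ
  P₁ = pp (a ∘ suc) (suc m)
  Q₁ = qq (a ∘ suc) (suc m)
  P₀ = pp (a ∘ suc) m
  Q₀ = qq (a ∘ suc) m
  regroup : ∀ c a₀ P₁ Q₁ P₀ Q₀ →
            c * (a₀ * P₁ + Q₁) + (a₀ * P₀ + Q₀) ≡ a₀ * (c * P₁ + P₀) + (c * Q₁ + Q₀)
  regroup = solve-∀

qq-tail : ∀ a m → qq a (suc m) ≡ pp (a ∘ suc) m
qq-tail a zero = refl
qq-tail a (suc zero) = cong (_+ + 1) (ℤP.*-zeroʳ (a 0))
qq-tail a (suc (suc m)) =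
  cong₂ (λ u v → a (suc m) * u + v) (qq-tail a (suc m)) (qq-tail a m)

-- Positive and nonnegative integers, witnessed so that sums and products compute.
IsPositive : ℤ → Set
IsPositive t = Σ ℕ λ m → t ≡ +[1+ m ]

IsNonNegative : ℤ → Set
IsNonNegative t = Σ ℕ λ m → t ≡ + m

positive-from-≤ : ∀ {t} → + 1 ℤ.≤ t → IsPositive t
positive-from-≤ (ℤ.+≤+ (s≤s {n = m} _)) = m , refl

positive≢0 : ∀ {t} → IsPositive t → t ≢ 0ℤ
positive≢0 (_ , refl) ()

positive-*-+ : ∀ {s t u} → IsPositive s → IsPositive t → IsNonNegative u → IsPositive (s * t + u)
positive-*-+ (_ , refl) (_ , refl) (_ , refl) = _ , refl

-- With positive partial quotients a₀, …, a_k, the numerators p_k are positive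
-- (and p_{k-1} is nonnegative, which carries the induction).
pp-positive : ∀ a k → (∀ j → j ≤ k → + 1 ℤ.≤ a j) →
              IsPositive (pp a (suc (suc k))) × IsNonNegative (pp a (suc k))
pp-positive a zero pos =
  positive-*-+ (positive-from-≤ (pos 0 z≤n)) (0 , refl) (0 , refl) , (1 , refl)
pp-positive a (suc k) pos with pp-positive a k (λ j j≤k → pos j (ℕP.m≤n⇒m≤1+n j≤k))
... | pₖ>0@(m , eq) , pₖ₋₁≥0 =
  positive-*-+ (positive-from-≤ (pos (suc k) ℕP.≤-refl)) pₖ>0 pₖ₋₁≥0 , (suc m , eq)

qq≢0 : ∀ a n → (∀ j → 1 ≤ j → j ≤ n → + 1 ℤ.≤ a j) → qq a (suc (suc n)) ≢ 0ℤ
qq≢0 a zero _ = subst (_≢ 0ℤ) (sym (qq-tail a 1)) (λ ())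
qq≢0 a (suc n) pos = subst (_≢ 0ℤ) (sym (qq-tail a (suc (suc n))))
  (positive≢0 (proj₁ (pp-positive (a ∘ suc) n (λ j j≤n → pos (suc j) (s≤s z≤n) (s≤s j≤n)))))

cf-coords : ∀ a k → (∀ j → 1 ≤ j → j ≤ k → + 1 ℤ.≤ a j) →
            coords (cf a k) ≍ (pp a (suc (suc k)) , qq a (suc (suc k)))
cf-coords a zero _ = ≍-≡ʳ (coords-/1 (a 0))
  (sym (trans (ℤP.+-identityʳ _) (ℤP.*-identityʳ (a 0)))) (sym (qq-tail a 1))
cf-coords a (suc k) pos = ≍-≡ʳ
  (coords-+ (a 0 ℚ./ 1) (inv tail) (coords-/1 (a 0)) (coords-inv tail tail-coords p'≢0))
  (trans (cong (λ t → a 0 * p' + t) (ℤP.*-identityʳ q')) (sym (pp-tail a (suc (suc k)))))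
  (trans (ℤP.*-identityˡ p') (sym (qq-tail a (suc (suc k)))))
  where
  tail : ℚ
  tail = cfFrom a k 1
  p' q' : ℤ
  p' = pp (a ∘ suc) (suc (suc k))
  q' = qq (a ∘ suc) (suc (suc k))
  pos' : ∀ j → j ≤ k → + 1 ℤ.≤ a (suc j)
  pos' j j≤k = pos (suc j) (s≤s z≤n) (s≤s j≤k)
  tail-coords : coords tail ≍ (p' , q')
  tail-coords = subst (λ t → coords t ≍ (p' , q')) (sym (cfFrom-shift a k 0))
    (cf-coords (a ∘ suc) k (λ j _ → pos' j))
  p'≢0 : p' ≢ 0ℤ
  p'≢0 = positive≢0 (proj₁ (pp-positive (a ∘ suc) k pos'))

aExt-≤ : ∀ a n k → k ≤ n → aExt a n k ≡ a k ℚ./ 1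
aExt-≤ a n k k≤n = cong (if_then a k ℚ./ 1 else aNext a n)
  (Equivalence.to T-≡ (ℕP.≤⇒≤ᵇ k≤n))

-- Needed to evaluate the test k ≤ᵇ n at k = n + 1.
<ᵇ-irrefl : ∀ n → (n ℕ.<ᵇ n) ≡ false
<ᵇ-irrefl zero = refl
<ᵇ-irrefl (suc n) = <ᵇ-irrefl n

aExt-last : ∀ a n → aExt a n (suc n) ≡ aNext a n
aExt-last a n = cong (if_then a (suc n) ℚ./ 1 else aNext a n) (<ᵇ-irrefl n)

coords-aNext : ∀ a n → qq a (suc (suc n)) ≢ 0ℤ →
               coords (aNext a n) ≍ (- qq a (suc n) , qq a (suc (suc n)))
coords-aNext a n qₙ≢0 = ≍-≡ʳ
  (coords-neg ((q₋ ℚ./ 1) ℚ.* inv (qₙ ℚ./ 1)) (coords-* (q₋ ℚ./ 1) (inv (qₙ ℚ./ 1)) (coords-/1 q₋)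
     (coords-inv (qₙ ℚ./ 1) (coords-/1 qₙ) qₙ≢0)))
  (cong -_ (ℤP.*-identityʳ q₋)) (ℤP.*-identityˡ qₙ)
  where
  q₋ qₙ : ℤ
  q₋ = qq a (suc n)
  qₙ = qq a (suc (suc n))

_≈_ : Sym → Sym → Set
ρ ≈ ρ' = (Sym.r ρ ~ Sym.r ρ') × (Sym.s ρ ~ Sym.s ρ')

sg² : ∀ k → sg k * sg k ≡ + 1
sg² zero = refl
sg² (suc k) = trans (neg-square (sg k)) (sg² k)
  where
  neg-square : ∀ t → - t * - t ≡ t * t
  neg-square = solve-∀

sign-cancel : ∀ s P x → s * s ≡ + 1 → s * P * (s * x) ≡ x * P
sign-cancel s P x s²≡1 = begin
  s * P * (s * x)    ≡⟨ solve (s ∷ P ∷ x ∷ []) ⟩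
  s * s * (x * P)    ≡⟨ cong (_* (x * P)) s²≡1 ⟩
  + 1 * (x * P)      ≡⟨ ℤP.*-identityˡ (x * P) ⟩
  x * P              ∎
  where open ≡-Reasoning

-- The images of ∞ = (1 : 0) and 0 = (0 : 1) are the columns of the matrix.
column-∞ : ∀ A B → A * + 1 + B * + 0 ≡ A
column-∞ A B = trans (cong₂ _+_ (ℤP.*-identityʳ A) (ℤP.*-zeroʳ B)) (ℤP.+-identityʳ A)

column-0 : ∀ A B → A * + 0 + B * + 1 ≡ B
column-0 A B = trans (cong₂ _+_ (ℤP.*-zeroʳ A) (ℤP.*-identityʳ B)) (ℤP.+-identityˡ B)

τ-start : ∀ a → actS (τ a 0) π₀∞ ≈ π₀∞
τ-start a = refl , refl

-- The telescoping identity τ_{k−1} π_∞((−1)^k a_k) = τ_k π₀(∞): the first column of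
-- τ_{k−1} is ± the second column of τ_k, and τ_{k−1}((−1)^k a_k) is ± the first
-- column of τ_k by the recursion p_k = a_k p_{k−1} + p_{k−2}.
τ-step : ∀ a k q → coords q ≍ (sg k * a k , + 1) →
         actS (τ a k) (π∞fin q) ≈ actS (τ a (suc k)) π₀∞
τ-step a k q e = ∞-image , q-image
  where
  s P₀ P₁ P₂ Q₀ Q₁ Q₂ : ℤ
  s  = sg k
  P₀ = pp a k
  P₁ = pp a (suc k)
  P₂ = pp a (suc (suc k))
  Q₀ = qq a k
  Q₁ = qq a (suc k)
  Q₂ = qq a (suc (suc k))
  ∞-image : actP (τ a k) ∞ ~ actP (τ a (suc k)) 0ₚ
  ∞-image = ≍⇒~ (actP (τ a k) ∞) (actP (τ a (suc k)) 0ₚ) (≍-≡ (≍-scaled s P₁ Q₁)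
    (sym (column-∞ (s * P₁) P₀)) (sym (column-∞ (s * Q₁) Q₀))
    (sym (column-0 (- s * P₂) P₁)) (sym (column-0 (- s * Q₂) Q₁)))
  W : P1
  W = ⟨ s * a k ∶ + 1 ∣ (λ { (_ , ()) }) ⟩
  signed : ∀ P P' → s * P * (s * a k) + P' * + 1 ≡ a k * P + P'
  signed P P' = cong₂ _+_ (sign-cancel s P (a k) (sg² k)) (ℤP.*-identityʳ P')
  W-image : actP (τ a k) W ~ actP (τ a (suc k)) ∞
  W-image = ≍⇒~ (actP (τ a k) W) (actP (τ a (suc k)) ∞) (≍-≡ (≍-sym (≍-scaled (- s) P₂ Q₂))
    (sym (signed P₁ P₀)) (sym (signed Q₁ Q₀))
    (sym (column-∞ (- s * P₂) P₁)) (sym (column-∞ (- s * Q₂) Q₁)))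
  q-image : actP (τ a k) (fin q) ~ actP (τ a (suc k)) ∞
  q-image = ~-trans (actP (τ a k) (fin q)) (actP (τ a k) W) (actP (τ a (suc k)) ∞)
    (actP-cong (τ a k) (fin q) W (≍⇒~ (fin q) W e)) W-image

-- The last term: τ_{m−1} maps ∞ to (p_{m−1} : q_{m−1}) and (−1)^m (−q_{m−2}/q_{m−1})
-- to ∞ = (1 : 0); for m = n + 1 these are r and the argument (−1)^{n+1} a_{n+1}.
τ-end : ∀ a m q r → qq a (suc m) ≢ 0ℤ →
        coords q ≍ (sg m * - qq a m , qq a (suc m)) →
        coords r ≍ (pp a (suc m) , qq a (suc m)) →
        actS (τ a m) (π∞fin q) ≈ πfin∞ r
τ-end a m q r Q'≢0 eq er = ∞-image , q-image
  where
  s Q Q' : ℤ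
  s  = sg m
  Q  = qq a m
  Q' = qq a (suc m)
  ∞-image : actP (τ a m) ∞ ~ fin r
  ∞-image = ≍⇒~ (actP (τ a m) ∞) (fin r) (≍-≡ (≍-sym (≍-scaleʳ s er))
    (sym (column-∞ (s * pp a (suc m)) (pp a m))) (sym (column-∞ (s * Q') Q)) refl refl)
  W : P1
  W = ⟨ s * - Q ∶ Q' ∣ (λ (_ , Q'≡0) → Q'≢0 Q'≡0) ⟩
  denominator≡0 : s * Q' * (s * - Q) + Q * Q' ≡ 0ℤ
  denominator≡0 = begin
    s * Q' * (s * - Q) + Q * Q'  ≡⟨ cong (_+ Q * Q') (sign-cancel s Q' (- Q) (sg² m)) ⟩
    - Q * Q' + Q * Q'            ≡⟨ cong (_+ Q * Q') (ℤP.neg-distribˡ-* Q Q') ⟨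
    - (Q * Q') + Q * Q'          ≡⟨ ℤP.+-inverseˡ (Q * Q') ⟩
    0ℤ                           ∎
    where open ≡-Reasoning
  W-image : actP (τ a m) W ~ ∞
  W-image = ~∞ (actP (τ a m) W) denominator≡0
  q-image : actP (τ a m) (fin q) ~ ∞
  q-image = ~-trans (actP (τ a m) (fin q)) (actP (τ a m) W) ∞
    (actP-cong (τ a m) (fin q) W (≍⇒~ (fin q) W eq)) W-image

≈-sym : ∀ ρ ρ' → ρ ≈ ρ' → ρ' ≈ ρ
≈-sym _ _ (e₁ , e₂) = sym e₁ , sym e₂

≈-trans : ∀ ρ₁ ρ₂ ρ₃ → ρ₁ ≈ ρ₂ → ρ₂ ≈ ρ₃ → ρ₁ ≈ ρ₃
≈-trans ρ₁ ρ₂ ρ₃ (e₁ , e₂) (f₁ , f₂) =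
  ~-trans (Sym.r ρ₁) (Sym.r ρ₂) (Sym.r ρ₃) e₁ f₁ , ~-trans (Sym.s ρ₁) (Sym.s ρ₂) (Sym.s ρ₃) e₂ f₂

δ : Sym → Sym → ℤ
δ ρ σ = if does (ρ ≈S? σ) then + 1 else 0ℤ

δ-cong : ∀ ρ ρ' σ → ρ ≈ ρ' → δ ρ σ ≡ δ ρ' σ
δ-cong ρ ρ' σ e = cong (if_then + 1 else 0ℤ)
  (does-⇔ (mk⇔ (≈-trans ρ' ρ σ (≈-sym ρ ρ' e)) (≈-trans ρ ρ' σ e)) (ρ ≈S? σ) (ρ' ≈S? σ))

coeff-++ : ∀ D E σ → coeff (D ++ E) σ ≡ coeff D σ + coeff E σ
coeff-++ [] E σ = sym (ℤP.+-identityˡ (coeff E σ))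
coeff-++ ((m , ρ) ∷ D) E σ = trans
  (cong (λ t → head + t) (coeff-++ D E σ)) (sym (ℤP.+-assoc head (coeff D σ) (coeff E σ)))
  where
  head : ℤ
  head = if does (ρ ≈S? σ) then m else 0ℤ

coeff-[,] : ∀ ρ ρ' σ → coeff [ ρ , ρ' ] σ ≡ δ ρ' σ - δ ρ σ
coeff-[,] ρ ρ' σ = unit-minus-unit (does (ρ' ≈S? σ)) (does (ρ ≈S? σ))
  where
  unit-minus-unit : ∀ b c → (if b then + 1 else 0ℤ) + ((if c then -[1+ 0 ] else 0ℤ) + 0ℤ)
                          ≡ (if b then + 1 else 0ℤ) - (if c then + 1 else 0ℤ)
  unit-minus-unit true true = refl
  unit-minus-unit true false = refl
  unit-minus-unit false true = refl
  unit-minus-unit false false = refl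

telescope : ∀ (α β : ℕ → Sym) m σ → (∀ k → k < m → α k ≈ β (suc k)) →
            coeff (ΣD m (λ k → [ α k , β k ])) σ ≡ δ (β 0) σ - δ (α m) σ
telescope α β zero σ _ = coeff-[,] (α 0) (β 0) σ
telescope α β (suc m) σ links = begin
  coeff (ΣD m segment ++ segment (suc m)) σ
    ≡⟨ coeff-++ (ΣD m segment) (segment (suc m)) σ ⟩
  coeff (ΣD m segment) σ + coeff (segment (suc m)) σ
    ≡⟨ cong₂ _+_ (telescope α β m σ (λ k k<m → links k (ℕP.m<n⇒m<1+n k<m)))
                 (coeff-[,] (α (suc m)) (β (suc m)) σ) ⟩
  (δ (β 0) σ - δ (α m) σ) + (δ (β (suc m)) σ - δ (α (suc m)) σ)
    ≡⟨ cong (λ t → (δ (β 0) σ - t) + (δ (β (suc m)) σ - δ (α (suc m)) σ)) (δ-cong (α m) (β (suc m)) σ (links m ℕP.≤-refl)) ⟩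
  (δ (β 0) σ - δ (β (suc m)) σ) + (δ (β (suc m)) σ - δ (α (suc m)) σ)
    ≡⟨ chain (δ (β 0) σ) (δ (β (suc m)) σ) (δ (α (suc m)) σ) ⟩
  δ (β 0) σ - δ (α (suc m)) σ  ∎
  where
  open ≡-Reasoning
  segment : ℕ → Div
  segment k = [ α k , β k ]
  chain : ∀ x y z → (x - y) + (y - z) ≡ x - z
  chain = solve-∀

-- The arguments (−1)^{j+1} a_{j+1} of the theorem, indexed by k = j + 1.
signedQuotient : (ℕ → ℤ) → ℕ → ℕ → ℚ
signedQuotient a n k = (sg k ℚ./ 1) ℚ.* aExt a n k

coords-signedQuotient : ∀ a n k → k ≤ n → coords (signedQuotient a n k) ≍ (sg k * a k , + 1)
coords-signedQuotient a n k k≤n = coords-int-* (sg k) (aExt a n k)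
  (subst (λ t → coords t ≍ (a k , + 1)) (sym (aExt-≤ a n k k≤n)) (coords-/1 (a k)))

coords-signedQuotient-last : ∀ a n → qq a (suc (suc n)) ≢ 0ℤ →
  coords (signedQuotient a n (suc n)) ≍ (sg (suc n) * - qq a (suc n) , qq a (suc (suc n)))
coords-signedQuotient-last a n qₙ≢0 = coords-int-* (sg (suc n)) (aExt a n (suc n))
  (subst (λ t → coords t ≍ (- qq a (suc n) , qq a (suc (suc n))))
     (sym (aExt-last a n)) (coords-aNext a n qₙ≢0))

mainTheorem8 : (n : ℕ) (a : ℕ → ℤ.ℤ)
    → (∀ i → 1 ≤ i → i ≤ n → + 1 ℤ.≤ a i)
    → (r : ℚ) → r ≡ cf a n
    → IsZeroDiv ([ π₀∞ , πfin∞ r ]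
        ++ ΣD (suc n) (λ k → τ a k ·D [ π∞fin ((sg k ℚ./ 1) ℚ.* aExt a n k) , π₀∞ ]))
mainTheorem8 n a pos r refl σ = begin
  coeff ([ π₀∞ , πfin∞ r ] ++ ΣD (suc n) (λ k → [ α k , β k ])) σ
    ≡⟨ coeff-++ [ π₀∞ , πfin∞ r ] (ΣD (suc n) (λ k → [ α k , β k ])) σ ⟩
  coeff [ π₀∞ , πfin∞ r ] σ + coeff (ΣD (suc n) (λ k → [ α k , β k ])) σ
    ≡⟨ cong₂ _+_ (coeff-[,] π₀∞ (πfin∞ r) σ) (telescope α β (suc n) σ links) ⟩
  (δ (πfin∞ r) σ - δ π₀∞ σ) + (δ (β 0) σ - δ (α (suc n)) σ)
    ≡⟨ cong₂ (λ u v → (δ (πfin∞ r) σ - δ π₀∞ σ) + (u - v))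
             (δ-cong (β 0) π₀∞ σ (τ-start a)) (δ-cong (α (suc n)) (πfin∞ r) σ last) ⟩
  (δ (πfin∞ r) σ - δ π₀∞ σ) + (δ π₀∞ σ - δ (πfin∞ r) σ)
    ≡⟨ cancel (δ (πfin∞ r) σ) (δ π₀∞ σ) ⟩
  0ℤ  ∎
  where
  open ≡-Reasoning
  α β : ℕ → Sym
  α k = actS (τ a k) (π∞fin (signedQuotient a n k))
  β k = actS (τ a k) π₀∞
  links : ∀ k → k < suc n → α k ≈ β (suc k)
  links k k<1+n = τ-step a k (signedQuotient a n k) (coords-signedQuotient a n k (ℕ.s≤s⁻¹ k<1+n))
  last : α (suc n) ≈ πfin∞ r
  last = τ-end a (suc n) (signedQuotient a n (suc n)) r (qq≢0 a n pos)
    (coords-signedQuotient-last a n (qq≢0 a n pos)) (cf-coords a n pos)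
  cancel : ∀ x y → (x - y) + (y - x) ≡ 0ℤ
  cancel = solve-∀
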